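{- Let $\Gamma$ be a base graph on $n$ vertices, labeled $1,\dots,n$, and let $G$ be a $\Gamma$-reseminant graph. For $i\in\{1,\dots,n\}$ let $V_i\subseteq V(G)$ be the set of true twins of the vertex $i$ in $G$ (including $i$), and let $h_i=|V_i|$. Then there exists a normal subgroup $H \trianglelefteq \mathrm{Aut}(G)$ with $H \cong S_{h_1}\times\cdots\times S_{h_n}$. Furthermore, $\mathrm{Aut}(G[V_1])\times\cdots\times\mathrm{Aut}(G[V_n]) \cong H$, where $G[V_i]$ is the induced subgraph of $G$ on $V_i$.
   Context: All graphs are finite, simple and undirected. $N_1[v]$ denotes the closed neighborhood of $v$ (the vertex $v$ and its neighbors). Two vertices $u,v$ are true twins if $N_1[u]=N_1[v]$. A base graph is a graph in which no two distinct vertices are true twins. Vertex duplication of a vertex $w$ adds a new vertex $w'$ adjacent exactly to the vertices of $N_1[w]$. A $\Gamma$-reseminant graph is a graph obtained from $\Gamma$ by a finite number (possibly zero) of vertex duplications; it contains $\Gamma$ as the induced subgraph on the original vertices $1,\dots,n$. $S_m$ is the symmetric group on $m$ letters. -}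

module Defs where

open import Data.Nat using (ℕ; zero; suc)
open import Data.Bool using (Bool; true; false; T; _∨_)
open import Data.Bool.Properties using () renaming (_≟_ to _≟ᵇ_)
open import Data.Fin using (Fin; zero; suc) renaming (_≟_ to _≟ᶠ_)
open import Data.Fin.Subset using (Subset; ∣_∣)
open import Data.Vec using (tabulate)
open import Data.List using (map)
open import Data.Bool.ListAction using (and)
open import Data.List.Base using (allFin)
open import Data.Product using (Σ; ∃; _,_; proj₁)
open import Data.Unit using (⊤)
open import Function using (_↔_; Inverse; id; _∘_)
open import Function.Properties.Inverse using (↔-refl; ↔-sym; ↔-trans)
open import Relation.Nullary using (does)
open import Relation.Binary.PropositionalEquality using (_≡_; refl)

record Graph (m : ℕ) : Set where
  field
    adj    : Fin m → Fin m → Bool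
    sym    : ∀ u v → adj u v ≡ adj v u
    irrefl : ∀ v → adj v v ≡ false
open Graph public

N₁ : ∀ {m} → Graph m → Fin m → Fin m → Bool
N₁ G u w = does (u ≟ᶠ w) ∨ adj G u w

twins? : ∀ {m} → Graph m → Fin m → Fin m → Bool
twins? {m} G u v = and (map (λ w → does (N₁ G u w ≟ᵇ N₁ G v w)) (allFin m))

IsBase : ∀ {n} → Graph n → Set
IsBase {n} Γ = ∀ (u v : Fin n) → T (twins? Γ u v) → u ≡ v

-- Vertex duplication: the new vertex w' is placed at index zero,
-- old vertex v is now at index suc v; w' is adjacent exactly to N₁[w].

dupAdj : ∀ {m} → Graph m → Fin m → Fin (suc m) → Fin (suc m) → Bool
dupAdj G w zero    zero    = false
dupAdj G w zero    (suc v) = N₁ G w v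
dupAdj G w (suc u) zero    = N₁ G w u
dupAdj G w (suc u) (suc v) = adj G u v

dupSym : ∀ {m} (G : Graph m) (w : Fin m) u v → dupAdj G w u v ≡ dupAdj G w v u
dupSym G w zero    zero    = refl
dupSym G w zero    (suc v) = refl
dupSym G w (suc u) zero    = refl
dupSym G w (suc u) (suc v) = sym G u v

dupIrr : ∀ {m} (G : Graph m) (w : Fin m) v → dupAdj G w v v ≡ false
dupIrr G w zero    = refl
dupIrr G w (suc v) = irrefl G v

duplicate : ∀ {m} → Graph m → Fin m → Graph (suc m)
duplicate G w = record { adj = dupAdj G w ; sym = dupSym G w ; irrefl = dupIrr G w }

-- Reseminant Γ m G e : G (on m vertices) is obtained from Γ by finitely
-- many vertex duplications; e sends original vertex i of Γ to its
-- position in G.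
data Reseminant {n : ℕ} (Γ : Graph n) : (m : ℕ) → Graph m → (Fin n → Fin m) → Set where
  base : Reseminant Γ n Γ id
  dup  : ∀ {m G e} → Reseminant Γ m G e → (w : Fin m) →
         Reseminant Γ (suc m) (duplicate G w) (suc ∘ e)

Twins : ∀ {m} → Graph m → Fin m → Set
Twins {m} G x = Σ (Fin m) (λ v → T (twins? G v x))

twinCount : ∀ {m} → Graph m → Fin m → ℕ
twinCount G x = ∣ tabulate (λ v → twins? G v x) ∣

Perm : Set → Set
Perm A = A ↔ A

_≈ₚ_ : ∀ {A} → Perm A → Perm A → Set
f ≈ₚ g = ∀ x → Inverse.to f x ≡ Inverse.to g x

idₚ : ∀ {A} → Perm A
idₚ = ↔-refl

-- (f ∘ₚ g) x = f (g x)
_∘ₚ_ : ∀ {A} → Perm A → Perm A → Perm A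
f ∘ₚ g = ↔-trans g f

_⁻¹ₚ : ∀ {A} → Perm A → Perm A
f ⁻¹ₚ = ↔-sym f

IsAut : ∀ {A : Set} → (A → A → Bool) → Perm A → Set
IsAut adj f = ∀ u v → adj (Inverse.to f u) (Inverse.to f v) ≡ adj u v

IsAutInduced : ∀ {m} (G : Graph m) (x : Fin m) → Perm (Twins G x) → Set
IsAutInduced G x = IsAut (λ a b → adj G (proj₁ a) (proj₁ b))

record IsNormalSubgroupOfAut {m} (G : Graph m) (H : Perm (Fin m) → Set) : Set where
  field
    ⊆Aut    : ∀ {f} → H f → IsAut (adj G) f
    resp    : ∀ {f g} → f ≈ₚ g → H f → H g
    has-id  : H idₚ
    ∘-closed : ∀ {f g} → H f → H g → H (f ∘ₚ g)
    ⁻¹-closed : ∀ {f} → H f → H (f ⁻¹ₚ)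
    normal  : ∀ {f g} → IsAut (adj G) g → H f → H ((g ∘ₚ f) ∘ₚ (g ⁻¹ₚ))

-- Direct product ∏ᵢ Kᵢ of permutation groups Kᵢ ≤ Sym(Aᵢ) (i : Fin n),
-- Kᵢ given by a predicate Pᵢ, with componentwise operation, and a group
-- isomorphism φ from it onto the subgroup H ≤ Sym(Fin m).

ProdCarrier : ∀ {n} (A : Fin n → Set) (P : (i : Fin n) → Perm (A i) → Set) → Set
ProdCarrier {n} A P = (i : Fin n) → Σ (Perm (A i)) (P i)

_≈∏_ : ∀ {n} {A : Fin n → Set} {P : (i : Fin n) → Perm (A i) → Set} →
       ProdCarrier A P → ProdCarrier A P → Set
x ≈∏ y = ∀ i → proj₁ (x i) ≈ₚ proj₁ (y i)

record IsIsoOnto {n m} (A : Fin n → Set) (P : (i : Fin n) → Perm (A i) → Set)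
                 (H : Perm (Fin m) → Set) (φ : ProdCarrier A P → Perm (Fin m)) : Set where
  field
    into       : ∀ x → H (φ x)
    cong       : ∀ {x y} → x ≈∏ y → φ x ≈ₚ φ y
    hom        : ∀ x y z → (∀ i → proj₁ (z i) ≈ₚ (proj₁ (x i) ∘ₚ proj₁ (y i))) →
                 φ z ≈ₚ (φ x ∘ₚ φ y)
    injective  : ∀ {x y} → φ x ≈ₚ φ y → x ≈∏ y
    surjective : ∀ {f} → H f → ∃ λ x → φ x ≈ₚ f

_≅_ : ∀ {n m} → (Σ (Fin n → Set) λ A → (i : Fin n) → Perm (A i) → Set) →
      (Perm (Fin m) → Set) → Set
_≅_ {m = m} (A , P) H = ∃ λ (φ : ProdCarrier A P → Perm (Fin m)) → IsIsoOnto A P H φ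

SymProd : ∀ {n} → (Fin n → ℕ) → Σ (Fin n → Set) λ A → (i : Fin n) → Perm (A i) → Set
SymProd h = (λ i → Fin (h i)) , (λ _ _ → ⊤)

AutTwinProd : ∀ {n m} → Graph m → (Fin n → Fin m) →
              Σ (Fin n → Set) λ A → (i : Fin n) → Perm (A i) → Set
AutTwinProd G e = (λ i → Twins G (e i)) , (λ i → IsAutInduced G (e i))

-- Being true twins is an equivalence relation on V(G), and duplicating a
-- vertex only adds a new member to an existing class. Since Γ has no twins,
-- the original vertices e 1, …, e n are a transversal of the classes of G, so
-- V(G) ≅ Σᵢ Vᵢ. The permutations fixing every class Vᵢ setwise are
-- automorphisms (twins have the same neighbourhood), and they form a normal
-- subgroup of Aut(G) because automorphisms map twin classes to twin classes.
-- This subgroup is ∏ᵢ Sym(Vᵢ) ≅ ∏ᵢ S_{hᵢ}; and as each Vᵢ is a clique,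
-- Aut(G[Vᵢ]) = Sym(Vᵢ) as well.
module Submission where

open import Defs hiding (sym)
open import Axiom.UniquenessOfIdentityProofs using (module Decidable⇒UIP)
open import Data.Bool using (Bool; true; false; T)
open import Data.Bool.Properties using (T-irrelevant) renaming (_≟_ to _≟ᵇ_)
open import Data.Fin using (Fin; zero; suc) renaming (_≟_ to _≟ᶠ_)
open import Data.Fin.Properties using (1↔⊤; +↔⊎)
open import Data.Fin.Subset using (Subset; ∣_∣)
open import Data.List.Base using (allFin)
open import Data.List.Membership.Propositional.Properties using (∈-allFin)
import Data.List.Relation.Unary.All as All
open import Data.List.Relation.Unary.All.Properties using (all⁺; all⁻)
open import Data.Nat using (zero; suc)
open import Data.Product using (Σ; ∃; _×_; _,_; proj₁; proj₂)
open import Data.Product.Properties using (,-injectiveʳ-UIP)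
open import Data.Sum using (_⊎_; inj₁; inj₂; [_,_])
open import Data.Sum.Function.Propositional using (_⊎-↔_)
open import Data.Unit using (tt)
open import Data.Vec using (_∷_; tabulate)
open import Function using (_↔_; Inverse; _∘_; id)
open import Function.Bundles using (mk↔ₛ′; Injection)
open import Function.Properties.Inverse using (↔-sym; ↔-trans; ↔⇒↣)
open import Relation.Nullary using (Dec; yes; no; does)
open import Relation.Nullary.Decidable using (dec-true; dec-false)
open import Relation.Binary.PropositionalEquality
  using (_≡_; _≢_; refl; sym; trans; cong; subst; module ≡-Reasoning)

open Inverse

T-does⁻ : ∀ {A : Set} (a? : Dec A) → T (does a?) → A
T-does⁻ (yes a) _ = a

T-does⁺ : ∀ {A : Set} (a? : Dec A) → A → T (does a?)
T-does⁺ a? a rewrite dec-true a? a = tt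

Perm-injective : ∀ {A : Set} (f : Perm A) {a b : A} → to f a ≡ to f b → a ≡ b
Perm-injective f = Injection.injective (↔⇒↣ f)

Twin : ∀ {m} → Graph m → Fin m → Fin m → Set
Twin G u v = ∀ t → N₁ G u t ≡ N₁ G v t

module _ {m} (G : Graph m) where

  twins?⇒Twin : ∀ {u v} → T (twins? G u v) → Twin G u v
  twins?⇒Twin {u} {v} h t =
    T-does⁻ (N₁ G u t ≟ᵇ N₁ G v t) (All.lookup (all⁺ _ (allFin m) h) (∈-allFin t))

  Twin⇒twins? : ∀ {u v} → Twin G u v → T (twins? G u v)
  Twin⇒twins? {u} {v} h =
    all⁻ _ {xs = allFin m} (All.tabulate λ {t} _ → T-does⁺ (N₁ G u t ≟ᵇ N₁ G v t) (h t))

  Twin-refl : ∀ {u} → Twin G u u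
  Twin-refl t = refl

  Twin-sym : ∀ {u v} → Twin G u v → Twin G v u
  Twin-sym h t = sym (h t)

  Twin-trans : ∀ {u v w} → Twin G u v → Twin G v w → Twin G u w
  Twin-trans h k t = trans (h t) (k t)

  N₁-refl : ∀ u → N₁ G u u ≡ true
  N₁-refl u rewrite dec-true (u ≟ᶠ u) refl = refl

  N₁-≢ : ∀ {u v} → u ≢ v → N₁ G u v ≡ adj G u v
  N₁-≢ {u} {v} u≢v rewrite dec-false (u ≟ᶠ v) u≢v = refl

  N₁-sym : ∀ u v → N₁ G u v ≡ N₁ G v u
  N₁-sym u v with u ≟ᶠ v
  ... | yes refl = sym (N₁-refl u)
  ... | no u≢v   = trans (Graph.sym G u v) (sym (N₁-≢ (u≢v ∘ sym)))

  Twin⇒adj : ∀ {u v} → Twin G u v → u ≢ v → adj G u v ≡ true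
  Twin⇒adj {u} {v} h u≢v = begin
    adj G u v ≡⟨ sym (N₁-≢ u≢v) ⟩
    N₁ G u v  ≡⟨ h v ⟩
    N₁ G v v  ≡⟨ N₁-refl v ⟩
    true      ∎
    where open ≡-Reasoning

  Twins-≡ : ∀ {x} {a b : Twins G x} → proj₁ a ≡ proj₁ b → a ≡ b
  Twins-≡ {a = v , p} {.v , q} refl = cong (v ,_) (T-irrelevant p q)

  Twins⇒Twin : ∀ {x} (a b : Twins G x) → Twin G (proj₁ a) (proj₁ b)
  Twins⇒Twin (u , p) (v , q) = Twin-trans (twins?⇒Twin p) (Twin-sym (twins?⇒Twin q))

  -- A twin class is a clique.
  Twins-perm-isAut : ∀ x (f : Perm (Twins G x)) → IsAutInduced G x f
  Twins-perm-isAut x f a b with proj₁ a ≟ᶠ proj₁ b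
  ... | yes a≡b with refl ← Twins-≡ {a = a} {b} a≡b = trans (irrefl G _) (sym (irrefl G _))
  ... | no a≢b = trans (Twin⇒adj (Twins⇒Twin (to f a) (to f b)) fa≢fb)
                       (sym (Twin⇒adj (Twins⇒Twin a b) a≢b))
    where
    fa≢fb : proj₁ (to f a) ≢ proj₁ (to f b)
    fa≢fb = a≢b ∘ cong proj₁ ∘ Perm-injective f ∘ Twins-≡

module _ {m} (G : Graph m) (w : Fin m) where

  Twin-duplicate⁺ : ∀ {u v} → Twin G u v → Twin (duplicate G w) (suc u) (suc v)
  Twin-duplicate⁺ {u} {v} h zero    = trans (N₁-sym G w u) (trans (h w) (N₁-sym G v w))
  Twin-duplicate⁺         h (suc t) = h t

  Twin-duplicate⁻ : ∀ {u v} → Twin (duplicate G w) (suc u) (suc v) → Twin G u v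
  Twin-duplicate⁻ h t = h (suc t)

  duplicate-Twin : Twin (duplicate G w) zero (suc w)
  duplicate-Twin zero    = sym (N₁-refl G w)
  duplicate-Twin (suc t) = refl

record TwinTransversal {n m} (G : Graph m) (e : Fin n → Fin m) : Set where
  field
    covers    : ∀ v → ∃ λ i → Twin G v (e i)
    separates : ∀ {i j} → Twin G (e i) (e j) → i ≡ j

reseminant⇒twinTransversal : ∀ {n m} {Γ : Graph n} {G : Graph m} {e : Fin n → Fin m} →
  IsBase Γ → Reseminant Γ m G e → TwinTransversal G e
reseminant⇒twinTransversal {Γ = Γ} isBase base = record
  { covers    = λ v → v , Twin-refl Γ
  ; separates = λ h → isBase _ _ (Twin⇒twins? Γ h)
  }
reseminant⇒twinTransversal isBase (dup {G = G} {e = e} r w) = record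
  { covers    = covers′
  ; separates = separates ∘ Twin-duplicate⁻ G w
  }
  where
  open TwinTransversal (reseminant⇒twinTransversal isBase r)
  covers′ : ∀ v → ∃ λ i → Twin (duplicate G w) v (suc (e i))
  covers′ zero    = let i , w~eᵢ = covers w in
    i , Twin-trans (duplicate G w) {zero} {suc w} {suc (e i)}
                   (duplicate-Twin G w) (Twin-duplicate⁺ G w w~eᵢ)
  covers′ (suc v) = let i , v~eᵢ = covers v in i , Twin-duplicate⁺ G w v~eᵢ

module _ {m} (G : Graph m) where

  TwinPreserving : Perm (Fin m) → Set
  TwinPreserving f = ∀ v → Twin G (to f v) v

  isAut⇒N₁-preserving : ∀ g → IsAut (adj G) g → ∀ a b → N₁ G (to g a) (to g b) ≡ N₁ G a b
  isAut⇒N₁-preserving g g-aut a b with a ≟ᶠ b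
  ... | yes refl = N₁-refl G (to g a)
  ... | no a≢b   = trans (N₁-≢ G (a≢b ∘ Perm-injective g)) (g-aut a b)

  N₁-preserving⇒isAut : ∀ g → (∀ a b → N₁ G (to g a) (to g b) ≡ N₁ G a b) → IsAut (adj G) g
  N₁-preserving⇒isAut g g-N₁ a b with a ≟ᶠ b
  ... | yes refl = trans (irrefl G _) (sym (irrefl G a))
  ... | no a≢b   = trans (sym (N₁-≢ G (a≢b ∘ Perm-injective g))) (trans (g-N₁ a b) (N₁-≢ G a≢b))

  isAut⇒Twin-preserving : ∀ g → IsAut (adj G) g → ∀ {a b} → Twin G a b → Twin G (to g a) (to g b)
  isAut⇒Twin-preserving g g-aut {a} {b} h t = begin
    N₁ G (to g a) t                ≡⟨ cong (N₁ G (to g a)) (sym (strictlyInverseˡ g t)) ⟩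
    N₁ G (to g a) (to g (from g t)) ≡⟨ isAut⇒N₁-preserving g g-aut a (from g t) ⟩
    N₁ G a (from g t)              ≡⟨ h (from g t) ⟩
    N₁ G b (from g t)              ≡⟨ isAut⇒N₁-preserving g g-aut b (from g t) ⟨
    N₁ G (to g b) (to g (from g t)) ≡⟨ cong (N₁ G (to g b)) (strictlyInverseˡ g t) ⟩
    N₁ G (to g b) t                ∎
    where open ≡-Reasoning

  TwinPreserving⇒isAut : ∀ {f} → TwinPreserving f → IsAut (adj G) f
  TwinPreserving⇒isAut {f} h = N₁-preserving⇒isAut f λ u v → begin
    N₁ G (to f u) (to f v) ≡⟨ h u (to f v) ⟩
    N₁ G u (to f v)        ≡⟨ N₁-sym G u (to f v) ⟩
    N₁ G (to f v) u        ≡⟨ h v u ⟩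
    N₁ G v u               ≡⟨ N₁-sym G v u ⟩
    N₁ G u v               ∎
    where open ≡-Reasoning

  TwinPreserving-normal : IsNormalSubgroupOfAut G TwinPreserving
  TwinPreserving-normal = record
    { ⊆Aut      = λ {f} → TwinPreserving⇒isAut {f}
    ; resp      = λ f≈g h v → subst (λ u → Twin G u v) (f≈g v) (h v)
    ; has-id    = λ v → Twin-refl G
    ; ∘-closed  = λ {_} {g} hf hg v → Twin-trans G (hf (to g v)) (hg v)
    ; ⁻¹-closed = λ {f} hf v →
        subst (Twin G (from f v)) (strictlyInverseˡ f v) (Twin-sym G (hf (from f v)))
    ; normal    = λ {f} {g} g-aut hf v →
        subst (Twin G (to g (to f (from g v)))) (strictlyInverseˡ g v)
              (isAut⇒Twin-preserving g g-aut (hf (from g v)))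
    }

module _ {I : Set} where

  fibrewise : {B C : I → Set} → (∀ i → B i ↔ C i) → Σ I B ↔ Σ I C
  fibrewise κ = mk↔ₛ′
    (λ p → proj₁ p , to (κ (proj₁ p)) (proj₂ p))
    (λ p → proj₁ p , from (κ (proj₁ p)) (proj₂ p))
    (λ p → cong (proj₁ p ,_) (strictlyInverseˡ (κ (proj₁ p)) (proj₂ p)))
    (λ p → cong (proj₁ p ,_) (strictlyInverseʳ (κ (proj₁ p)) (proj₂ p)))

  module _ {B : I → Set} where

    FibrePreserving : Perm (Σ I B) → Set
    FibrePreserving g = ∀ p → proj₁ (to g p) ≡ proj₁ p

    fibre : ∀ {i} (p : Σ I B) → proj₁ p ≡ i → B i
    fibre (_ , b) refl = b

    fibre-η : ∀ {i} (p : Σ I B) (eq : proj₁ p ≡ i) → (i , fibre p eq) ≡ p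
    fibre-η (_ , b) refl = refl

    fibre-unique : ∀ {i b} (p : Σ I B) → p ≡ (i , b) → (eq : proj₁ p ≡ i) → fibre p eq ≡ b
    fibre-unique _ refl refl = refl

    FibrePreserving-from : ∀ g → FibrePreserving g → ∀ p → proj₁ (from g p) ≡ proj₁ p
    FibrePreserving-from g g-pres p = trans (sym (g-pres (from g p))) (cong proj₁ (strictlyInverseˡ g p))

    restrict : ∀ g → FibrePreserving g → ∀ i → Perm (B i)
    restrict g g-pres i = mk↔ₛ′ to′ from′ to′∘from′ from′∘to′
      where
      from-pres = FibrePreserving-from g g-pres
      to′ from′ : B i → B i
      to′   b = fibre (to g (i , b)) (g-pres (i , b))
      from′ b = fibre (from g (i , b)) (from-pres (i , b))
      to′∘from′ : ∀ b → to′ (from′ b) ≡ b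
      to′∘from′ b = fibre-unique _
        (trans (cong (to g) (fibre-η (from g (i , b)) (from-pres (i , b)))) (strictlyInverseˡ g (i , b)))
        (g-pres (i , from′ b))
      from′∘to′ : ∀ b → from′ (to′ b) ≡ b
      from′∘to′ b = fibre-unique _
        (trans (cong (from g) (fibre-η (to g (i , b)) (g-pres (i , b)))) (strictlyInverseʳ g (i , b)))
        (from-pres (i , to′ b))

    fibrewise-restrict : ∀ g g-pres p → to (fibrewise (restrict g g-pres)) p ≡ to g p
    fibrewise-restrict g g-pres (i , b) = fibre-η (to g (i , b)) (g-pres (i , b))

module _ {n m} {B : Fin n → Set} (ψ : Fin m ↔ Σ (Fin n) B) where

  ClassPreserving : Perm (Fin m) → Set
  ClassPreserving f = ∀ v → proj₁ (to ψ (to f v)) ≡ proj₁ (to ψ v)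

  ∏Sym≅ClassPreserving : (P : ∀ i → Perm (B i) → Set) → (∀ i f → P i f) →
                        (B , P) ≅ ClassPreserving
  ∏Sym≅ClassPreserving P allP = φ , record
    { into       = λ x v → cong proj₁ (strictlyInverseˡ ψ _)
    ; cong       = λ x≈y v → cong (from ψ) (cong (proj₁ (to ψ v) ,_) (x≈y _ _))
    ; hom        = λ x y z z≈xy v → cong (from ψ)
                     (trans (cong (proj₁ (to ψ v) ,_) (z≈xy _ _))
                            (cong (σ x) (sym (strictlyInverseˡ ψ _))))
    ; injective  = λ {x} {y} → injective {x} {y}
    ; surjective = λ {f} → surjective {f}
    }
    where
    σ : ProdCarrier B P → Σ (Fin n) B → Σ (Fin n) B
    σ x = to (fibrewise (proj₁ ∘ x))

    φ : ProdCarrier B P → Perm (Fin m)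
    φ x = ↔-trans ψ (↔-trans (fibrewise (proj₁ ∘ x)) (↔-sym ψ))

    injective : ∀ {x y} → φ x ≈ₚ φ y → x ≈∏ y
    injective {x} {y} φx≈φy i b = ,-injectiveʳ-UIP (Decidable⇒UIP.≡-irrelevant _≟ᶠ_) (begin
      (i , to (proj₁ (x i)) b)  ≡⟨ cong (σ x) (strictlyInverseˡ ψ (i , b)) ⟨
      σ x (to ψ v)              ≡⟨ strictlyInverseˡ ψ _ ⟨
      to ψ (to (φ x) v)         ≡⟨ cong (to ψ) (φx≈φy v) ⟩
      to ψ (to (φ y) v)         ≡⟨ strictlyInverseˡ ψ _ ⟩
      σ y (to ψ v)              ≡⟨ cong (σ y) (strictlyInverseˡ ψ (i , b)) ⟩
      (i , to (proj₁ (y i)) b)  ∎)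
      where
      open ≡-Reasoning
      v = from ψ (i , b)

    surjective : ∀ {f} → ClassPreserving f → ∃ λ x → φ x ≈ₚ f
    surjective {f} f-pres = x , λ v → begin
      from ψ (σ x (to ψ v))               ≡⟨ cong (from ψ) (fibrewise-restrict g g-pres (to ψ v)) ⟩
      from ψ (to ψ (to f (from ψ (to ψ v)))) ≡⟨ strictlyInverseʳ ψ _ ⟩
      to f (from ψ (to ψ v))             ≡⟨ cong (to f) (strictlyInverseʳ ψ v) ⟩
      to f v                             ∎
      where
      open ≡-Reasoning
      g : Perm (Σ (Fin n) B)
      g = ↔-trans (↔-sym ψ) (↔-trans f ψ)
      g-pres : FibrePreserving g
      g-pres p = trans (f-pres (from ψ p)) (cong proj₁ (strictlyInverseˡ ψ p))
      x : ProdCarrier B P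
      x i = restrict g g-pres i , allP i _

≅-resp : ∀ {n m} {X : Σ (Fin n → Set) λ A → (i : Fin n) → Perm (A i) → Set}
           {H H′ : Perm (Fin m) → Set} →
         (∀ f → H f → H′ f) → (∀ f → H′ f → H f) → X ≅ H → X ≅ H′
≅-resp H⇒H′ H′⇒H (φ , iso) = φ , record
  { into       = λ x → H⇒H′ _ (IsIsoOnto.into iso x)
  ; cong       = IsIsoOnto.cong iso
  ; hom        = IsIsoOnto.hom iso
  ; injective  = IsIsoOnto.injective iso
  ; surjective = λ {f} → IsIsoOnto.surjective iso ∘ H′⇒H f
  }

module _ {n m} {G : Graph m} {e : Fin n → Fin m} (τ : TwinTransversal G e) where
  open TwinTransversal τ

  twinClass : Fin m → Fin n
  twinClass v = proj₁ (covers v)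

  Twin⇒twinClass-≡ : ∀ {u v} → Twin G u v → twinClass u ≡ twinClass v
  Twin⇒twinClass-≡ {u} {v} h = separates
    (Twin-trans G (Twin-sym G (proj₂ (covers u))) (Twin-trans G h (proj₂ (covers v))))

  twinClass-≡⇒Twin : ∀ {u v} → twinClass u ≡ twinClass v → Twin G u v
  twinClass-≡⇒Twin {u} {v} eq = Twin-trans G (proj₂ (covers u))
    (subst (λ i → Twin G (e i) v) (sym eq) (Twin-sym G (proj₂ (covers v))))

  twinClasses : Fin m ↔ Σ (Fin n) (λ i → Twins G (e i))
  twinClasses = mk↔ₛ′ classify member classify-member (λ v → refl)
    where
    classify : Fin m → Σ (Fin n) (λ i → Twins G (e i))
    classify v = twinClass v , v , Twin⇒twins? G (proj₂ (covers v))
    member : Σ (Fin n) (λ i → Twins G (e i)) → Fin m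
    member (_ , v , _) = v
    member-≡ : ∀ v {i j} (p : T (twins? G v (e i))) (q : T (twins? G v (e j))) →
               i ≡ j → _≡_ {A = Σ (Fin n) (λ k → Twins G (e k))} (i , v , p) (j , v , q)
    member-≡ v {i} p q refl = cong (λ r → i , v , r) (T-irrelevant p q)
    classify-member : ∀ c → classify (member c) ≡ c
    classify-member (i , v , p) =
      member-≡ v _ p (separates (Twin-trans G (Twin-sym G (proj₂ (covers v))) (twins?⇒Twin G p)))

  TwinPreserving⇒ClassPreserving : ∀ f → TwinPreserving G f → ClassPreserving twinClasses f
  TwinPreserving⇒ClassPreserving f f-pres v = Twin⇒twinClass-≡ (f-pres v)

  ClassPreserving⇒TwinPreserving : ∀ f → ClassPreserving twinClasses f → TwinPreserving G f
  ClassPreserving⇒TwinPreserving f f-pres v = twinClass-≡⇒Twin (f-pres v)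

Σ-Fin-suc↔ : ∀ {m} (P : Fin (suc m) → Set) → Σ (Fin (suc m)) P ↔ (P zero ⊎ Σ (Fin m) (P ∘ suc))
Σ-Fin-suc↔ P = mk↔ₛ′ split join split∘join join∘split
  where
  split : Σ (Fin _) P → P zero ⊎ Σ (Fin _) (P ∘ suc)
  split (zero  , p) = inj₁ p
  split (suc i , p) = inj₂ (i , p)
  join : P zero ⊎ Σ (Fin _) (P ∘ suc) → Σ (Fin _) P
  join (inj₁ p)       = zero , p
  join (inj₂ (i , p)) = suc i , p
  split∘join : ∀ q → split (join q) ≡ q
  split∘join (inj₁ p) = refl
  split∘join (inj₂ q) = refl
  join∘split : ∀ q → join (split q) ≡ q
  join∘split (zero  , p) = refl
  join∘split (suc i , p) = refl

T⊎↔Fin∣∷∣ : ∀ b {k} {xs : Subset k} {X : Set} → X ↔ Fin ∣ xs ∣ → (T b ⊎ X) ↔ Fin ∣ b ∷ xs ∣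
T⊎↔Fin∣∷∣ false X↔ = ↔-trans (mk↔ₛ′ [ (λ ()) , id ] inj₂ (λ _ → refl) [ (λ ()) , (λ _ → refl) ]) X↔
T⊎↔Fin∣∷∣ true  X↔ = ↔-trans (↔-sym 1↔⊤ ⊎-↔ X↔) (↔-sym +↔⊎)

Σ-T↔Fin∣tabulate∣ : ∀ {m} (p : Fin m → Bool) → Σ (Fin m) (T ∘ p) ↔ Fin ∣ tabulate p ∣
Σ-T↔Fin∣tabulate∣ {zero}  p = mk↔ₛ′ (λ { (() , _) }) (λ ()) (λ ()) (λ { (() , _) })
Σ-T↔Fin∣tabulate∣ {suc m} p =
  ↔-trans (Σ-Fin-suc↔ (T ∘ p)) (T⊎↔Fin∣∷∣ (p zero) {xs = tabulate (p ∘ suc)} (Σ-T↔Fin∣tabulate∣ (p ∘ suc)))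

Twins↔Fin-twinCount : ∀ {m} (G : Graph m) x → Twins G x ↔ Fin (twinCount G x)
Twins↔Fin-twinCount G x = Σ-T↔Fin∣tabulate∣ (λ v → twins? G v x)

mainTheorem3 : ∀ {n m} (Γ : Graph n) (G : Graph m) (e : Fin n → Fin m) →
    IsBase Γ → Reseminant Γ m G e →
    ∃ λ (H : Perm (Fin m) → Set) →
      IsNormalSubgroupOfAut G H
      × (SymProd (λ i → twinCount G (e i)) ≅ H)
      × (AutTwinProd G e ≅ H)
mainTheorem3 {n} {m} Γ G e isBase r =
  TwinPreserving G , TwinPreserving-normal G , ∏S≅H , ∏Aut≅H
  where
  τ : TwinTransversal G e
  τ = reseminant⇒twinTransversal isBase r

  -- fibrewise keeps the class index, so ClassPreserving means the same for
  -- both partitions and the same conversion lemmas apply.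
  numberedTwinClasses : Fin m ↔ Σ (Fin n) (λ i → Fin (twinCount G (e i)))
  numberedTwinClasses = ↔-trans (twinClasses τ) (fibrewise λ i → Twins↔Fin-twinCount G (e i))

  ∏S≅H : SymProd (λ i → twinCount G (e i)) ≅ TwinPreserving G
  ∏S≅H = ≅-resp (ClassPreserving⇒TwinPreserving τ) (TwinPreserving⇒ClassPreserving τ)
           (∏Sym≅ClassPreserving numberedTwinClasses _ (λ _ _ → tt))

  ∏Aut≅H : AutTwinProd G e ≅ TwinPreserving G
  ∏Aut≅H = ≅-resp (ClassPreserving⇒TwinPreserving τ) (TwinPreserving⇒ClassPreserving τ)
             (∏Sym≅ClassPreserving (twinClasses τ) _ (Twins-perm-isAut G ∘ e))
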